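{- Let $G$ be a finite non-cyclic abelian group which is not a $p$-group, with $G\cong G_1\times\mathbb{Z}_n$, where $\gcd(|G_1|,n)=1$ and $G_1$ is a $p$-group (for some prime $p$) having no cyclic Sylow subgroup. Then $\kappa(\mathcal{G}_e(G))=n$.
   Context: For a finite group $G$, the enhanced power graph $\mathcal{G}_e(G)$ is the simple graph with vertex set $G$ in which two distinct vertices $u,v$ are adjacent if and only if there exists $w\in G$ such that both $u$ and $v$ are powers of $w$. For a graph $\Gamma$, the vertex connectivity $\kappa(\Gamma)$ is the minimum number of vertices whose removal leaves an induced subgraph that is disconnected. A $p$-group is a group of order $p^r$, $r\in\mathbb{N}$. -}

module Defs where

open import Data.Nat using (ℕ; zero; suc; _<_; _^_)
open import Data.Nat.GCD using (gcd)
open import Data.Nat.Primality using (Prime)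
open import Data.Fin using (Fin)
open import Data.Fin.Subset using (Subset; _∉_; ∣_∣)
open import Data.Product using (Σ; ∃; ∃-syntax; _×_; _,_; proj₁; proj₂)
open import Relation.Nullary using (¬_)
open import Relation.Binary.PropositionalEquality using (_≡_; _≢_)

-- Finite groups: a finite group of order N is presented on the carrier
-- Fin N (every finite group is isomorphic to such a group).

record FinGroup : Set where
  infixl 7 _∙_
  field
    order     : ℕ
    _∙_       : Fin order → Fin order → Fin order
    ε         : Fin order
    _⁻¹       : Fin order → Fin order
    assoc     : ∀ x y z → (x ∙ y) ∙ z ≡ x ∙ (y ∙ z)
    identityˡ : ∀ x → ε ∙ x ≡ x
    identityʳ : ∀ x → x ∙ ε ≡ x
    inverseˡ  : ∀ x → (x ⁻¹) ∙ x ≡ ε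
    inverseʳ  : ∀ x → x ∙ (x ⁻¹) ≡ ε

  Carrier : Set
  Carrier = Fin order

  pow : Carrier → ℕ → Carrier
  pow w zero    = ε
  pow w (suc k) = w ∙ pow w k

open FinGroup public using (order; Carrier; pow)

module _ (G : FinGroup) where
  open FinGroup G hiding (pow; order; Carrier)

  IsAbelian : Set
  IsAbelian = ∀ x y → x ∙ y ≡ y ∙ x

  IsCyclic : Set
  IsCyclic = ∃[ g ] (∀ x → ∃[ k ] (x ≡ pow G g k))

  IsPGroupFor : ℕ → Set
  IsPGroupFor p = Prime p × ∃[ r ] (order G ≡ p ^ r)

  IsPGroup : Set
  IsPGroup = ∃[ p ] IsPGroupFor p

record IsoToProduct (G G₁ H : FinGroup) : Set where
  private
    module G  = FinGroup G
    module G₁ = FinGroup G₁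
    module H  = FinGroup H
  field
    f          : G.Carrier → G₁.Carrier × H.Carrier
    injective  : ∀ x y → f x ≡ f y → x ≡ y
    surjective : ∀ z → ∃[ x ] (f x ≡ z)
    homo       : ∀ x y → f (x G.∙ y) ≡
                   (proj₁ (f x) G₁.∙ proj₁ (f y) , proj₂ (f x) H.∙ proj₂ (f y))

EnhancedPowerAdj : (G : FinGroup) → Carrier G → Carrier G → Set
EnhancedPowerAdj G u v =
  u ≢ v × ∃[ w ] ∃[ a ] ∃[ b ] (u ≡ pow G w a × v ≡ pow G w b)

module _ {N : ℕ} (Adj : Fin N → Fin N → Set) where

  data ReachAvoiding (S : Subset N) : Fin N → Fin N → Set where
    here : ∀ {x} → x ∉ S → ReachAvoiding S x x
    step : ∀ {x y z} → x ∉ S → Adj x y → ReachAvoiding S y z →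
           ReachAvoiding S x z

  Disconnects : Subset N → Set
  Disconnects S = ∃[ x ] ∃[ y ] (x ∉ S × y ∉ S × ¬ ReachAvoiding S x y)

  IsVertexConnectivity : ℕ → Set
  IsVertexConnectivity k =
    (∃[ S ] (∣ S ∣ ≡ k × Disconnects S)) ×
    (∀ (S : Subset N) → ∣ S ∣ < k → ¬ Disconnects S)

module Submission where

-- κ(𝒢ₑ(G)) = n  for an abelian G ≅ G₁ × ℤₙ with G₁ a non-cyclic p-group and
-- gcd(|G₁|, n) = 1.  Let Hˢ be the copy of ℤₙ = H inside G (elements with
-- trivial G₁-component); it has n vertices.
--
-- By the Chinese remainder theorem ⟨(a , b)⟩ = ⟨a⟩ × ⟨b⟩, so
-- for a generator g of H every u is a power of (u₁ , g), as is every element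
-- (ε , h) of Hˢ: each vertex of Hˢ dominates the graph, and a vertex set of
-- size < n misses one of them and cannot disconnect.
--
-- Fix a of order p in G₁.  Along a path avoiding Hˢ the
-- property "a is a power of the G₁-component" is preserved, because a cyclic
-- p-group has a unique subgroup of order p.  Since G₁ is not cyclic it has an
-- element b of order p outside ⟨a⟩ (cyclicity criterion for abelian p-groups),
-- and (a , ε), (b , ε) lie in different components of 𝒢ₑ(G) − Hˢ.

open import Defs
open import Level using (0ℓ)
open import Algebra.Bundles using (Group; CommutativeMonoid)
open import Data.Nat using (ℕ; zero; suc; pred; _+_; _*_; _^_; _≤_; _<_; NonZero; _%_; _/_)
open import Data.Nat.Properties using (*-comm; +-comm; suc-pred; m^n≢0; ≮⇒≥; <⇒≢; <⇒≱; ≤-antisym)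
open import Data.Nat.Divisibility using (_∣_; _∣?_; divides; ∣1⇒≡1; *-cancelˡ-∣; *-cancelʳ-∣; *-monoˡ-∣)
open import Data.Nat.DivMod using (m≡m%n+[m/n]*n; m%n<n)
open import Data.Nat.GCD using (gcd; gcd-GCD; gcd[m,n]∣m; gcd[m,n]∣n; module Bézout)
open import Data.Nat.Coprimality as Coprimality using (Coprime; coprime-Bézout; coprime-divisor; gcd≡1⇒coprime)
open import Data.Nat.Primality using (Prime; prime⇒irreducible; prime⇒nonZero)
open import Data.Nat.Tactic.RingSolver using (solve-∀)
open import Data.Fin using (Fin; zero; suc; toℕ; fromℕ<) renaming (_≟_ to _≟ᶠ_)
open import Data.Fin.Properties using (all?; any?; ¬∀⟶∃¬; pigeonhole; suc-injective; toℕ-fromℕ<; nonZeroIndex)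
open import Data.Fin.Permutation using (Permutation; permutation)
open import Data.Fin.Subset using (Subset; _∈_; _∉_; ∣_∣; inside; outside)
open import Data.Fin.Subset.Properties using (_∈?_)
open import Data.Vec using (_∷_; tabulate; here; there)
open import Data.Vec.Properties using (lookup⇒[]=; []=⇒lookup; lookup∘tabulate)
open import Data.Product using (_×_; ∃-syntax; _,_; proj₁; proj₂)
open import Data.Sum using (_⊎_; inj₁; inj₂)
open import Data.Empty using (⊥-elim)
open import Relation.Nullary using (¬_; Dec; yes; no; does; contradiction)
open import Relation.Nullary.Decidable using (_→-dec_)
open import Relation.Binary.PropositionalEquality

module Powers (G : FinGroup) where
  open FinGroup G hiding (order; Carrier; pow)

  group : Group 0ℓ 0ℓ
  group = record
    { Carrier = Carrier G ; _≈_ = _≡_ ; _∙_ = _∙_ ; ε = ε ; _⁻¹ = _⁻¹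
    ; isGroup = record
      { isMonoid = record
        { isSemigroup = record
          { isMagma = record { isEquivalence = isEquivalence ; ∙-cong = cong₂ _∙_ }
          ; assoc = assoc }
        ; identity = identityˡ , identityʳ }
      ; inverse = inverseˡ , inverseʳ
      ; ⁻¹-cong = cong _⁻¹ } }

  open import Algebra.Properties.Group group public
    using (identityˡ-unique; identityʳ-unique; inverseˡ-unique; inverseʳ-unique)
  open import Algebra.Properties.Monoid.Mult (Group.monoid group) public using (×-homo-+; ×-assocˡ)
    renaming (_×_ to _·_)

  pw : Carrier G → ℕ → Carrier G
  pw = pow G

  _∈⟨_⟩ : Carrier G → Carrier G → Set
  x ∈⟨ g ⟩ = ∃[ k ] pw g k ≡ x

  pow≡× : ∀ x k → pw x k ≡ k · x
  pow≡× x zero    = refl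
  pow≡× x (suc k) = cong (x ∙_) (pow≡× x k)

  pow-1 : ∀ x → pw x 1 ≡ x
  pow-1 = identityʳ

  pow-ε : ∀ k → pw ε k ≡ ε
  pow-ε zero    = refl
  pow-ε (suc k) = trans (identityˡ _) (pow-ε k)

  pow-+ : ∀ x a b → pw x (a + b) ≡ pw x a ∙ pw x b
  pow-+ x a b rewrite pow≡× x (a + b) | pow≡× x a | pow≡× x b = ×-homo-+ x a b

  pow-* : ∀ x a b → pw x (a * b) ≡ pw (pw x a) b
  pow-* x a b rewrite pow≡× x (a * b) | pow≡× (pw x a) b | pow≡× x a =
    trans (cong (_· x) (*-comm a b)) (sym (×-assocˡ x b a))

  pow-∣ : ∀ x {m k} → pw x m ≡ ε → m ∣ k → pw x k ≡ ε
  pow-∣ x {m} xᵐ≡ε (divides q refl) = begin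
    pw x (q * m)   ≡⟨ cong (pw x) (*-comm q m) ⟩
    pw x (m * q)   ≡⟨ pow-* x m q ⟩
    pw (pw x m) q  ≡⟨ cong (λ y → pw y q) xᵐ≡ε ⟩
    pw ε q         ≡⟨ pow-ε q ⟩
    ε              ∎
    where open ≡-Reasoning

  pow-1+ : ∀ x m s → pw x m ≡ ε → pw x (1 + m * s) ≡ x
  pow-1+ x m s xᵐ≡ε = begin
    pw x (1 + m * s)       ≡⟨ pow-+ x 1 (m * s) ⟩
    pw x 1 ∙ pw x (m * s)  ≡⟨ cong₂ _∙_ (pow-1 x) (pow-∣ x xᵐ≡ε (divides s (*-comm m s))) ⟩
    x ∙ ε                  ≡⟨ identityʳ x ⟩
    x                      ∎
    where open ≡-Reasoning

  pow-cancel : ∀ x {d u v} → pw x u ≡ ε → pw x v ≡ ε → d + u ≡ v → pw x d ≡ ε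
  pow-cancel x {d} {u} {v} xᵘ≡ε xᵛ≡ε d+u≡v = begin
    pw x d           ≡⟨ sym (identityʳ _) ⟩
    pw x d ∙ ε       ≡⟨ cong (pw x d ∙_) (sym xᵘ≡ε) ⟩
    pw x d ∙ pw x u  ≡⟨ sym (pow-+ x d u) ⟩
    pw x (d + u)     ≡⟨ cong (pw x) d+u≡v ⟩
    pw x v           ≡⟨ xᵛ≡ε ⟩
    ε                ∎
    where open ≡-Reasoning

  pow-gcd : ∀ x m k → pw x m ≡ ε → pw x k ≡ ε → pw x (gcd m k) ≡ ε
  pow-gcd x m k xᵐ≡ε xᵏ≡ε with Bézout.identity (gcd-GCD m k)
  ... | Bézout.+- a b eq = pow-cancel x {gcd m k} (pow-∣ x xᵏ≡ε (divides b refl)) (pow-∣ x xᵐ≡ε (divides a refl)) eq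
  ... | Bézout.-+ a b eq = pow-cancel x {gcd m k} (pow-∣ x xᵐ≡ε (divides a refl)) (pow-∣ x xᵏ≡ε (divides b refl)) eq

  ∈⟨⟩-trans : ∀ {x y z} → x ∈⟨ y ⟩ → y ∈⟨ z ⟩ → x ∈⟨ z ⟩
  ∈⟨⟩-trans {z = z} (i , yⁱ≡x) (j , zʲ≡y) =
    j * i , trans (pow-* z j i) (trans (cong (λ y → pw y i) zʲ≡y) yⁱ≡x)

  ⁻¹-as-power : ∀ x n → pw x (suc n) ≡ ε → x ⁻¹ ≡ pw x n
  ⁻¹-as-power x n xⁿ⁺¹≡ε = sym (inverseʳ-unique x (pw x n) xⁿ⁺¹≡ε)

  coprime-power-generates : ∀ z n k → pw z (suc n) ≡ ε → Coprime k (suc n) → z ∈⟨ pw z k ⟩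
  coprime-power-generates z n k zⁿ⁺¹≡ε k⊥n+1 with coprime-Bézout k⊥n+1
  ... | Bézout.+- a b 1+b*[n+1]≡a*k = a , (begin
    pw (pw z k) a          ≡⟨ sym (pow-* z k a) ⟩
    pw z (k * a)           ≡⟨ cong (pw z) (*-comm k a) ⟩
    pw z (a * k)           ≡⟨ cong (pw z) (sym 1+b*[n+1]≡a*k) ⟩
    pw z (1 + b * suc n)   ≡⟨ cong (λ t → pw z (1 + t)) (*-comm b (suc n)) ⟩
    pw z (1 + suc n * b)   ≡⟨ pow-1+ z (suc n) b zⁿ⁺¹≡ε ⟩
    z                      ∎)
    where open ≡-Reasoning
  ... | Bézout.-+ a b 1+a*k≡b*[n+1] = a * n , (begin
    pw (pw z k) (a * n)    ≡⟨ pow-* (pw z k) a n ⟩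
    pw u n                 ≡⟨ sym (⁻¹-as-power u n uⁿ⁺¹≡ε) ⟩
    u ⁻¹                   ≡⟨ sym (inverseˡ-unique z u z∙u≡ε) ⟩
    z                      ∎)
    where
      open ≡-Reasoning
      u = pw (pw z k) a
      u≡ : u ≡ pw z (a * k)
      u≡ = trans (sym (pow-* z k a)) (cong (pw z) (*-comm k a))
      z∙u≡ε : z ∙ u ≡ ε
      z∙u≡ε = trans (cong (z ∙_) u≡)
                (trans (cong (pw z) 1+a*k≡b*[n+1]) (pow-∣ z zⁿ⁺¹≡ε (divides b refl)))
      uⁿ⁺¹≡ε : pw u (suc n) ≡ ε
      uⁿ⁺¹≡ε = trans (cong (λ y → pw y (suc n)) u≡)
                 (trans (sym (pow-* z (a * k) (suc n))) (pow-∣ z zⁿ⁺¹≡ε (divides (a * k) refl)))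

  order-nonZero : NonZero (order G)
  order-nonZero = nonZeroIndex ε

  pow-mod : ∀ x m k .{{_ : NonZero m}} → pw x m ≡ ε → pw x (k % m) ≡ pw x k
  pow-mod x m k xᵐ≡ε = begin
    pw x (k % m)                     ≡⟨ sym (identityʳ _) ⟩
    pw x (k % m) ∙ ε                 ≡⟨ cong (pw x (k % m) ∙_) (sym (pow-∣ x xᵐ≡ε (divides (k / m) refl))) ⟩
    pw x (k % m) ∙ pw x (k / m * m)  ≡⟨ sym (pow-+ x (k % m) (k / m * m)) ⟩
    pw x (k % m + k / m * m)         ≡⟨ cong (pw x) (sym (m≡m%n+[m/n]*n k m)) ⟩
    pw x k                           ∎
    where open ≡-Reasoning

  pow-projection : ∀ x E F i j → pw x E ≡ x → pw x F ≡ ε → pw x (E * i + F * j) ≡ pw x i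
  pow-projection x E F i j xᴱ≡x xᶠ≡ε = begin
    pw x (E * i + F * j)             ≡⟨ pow-+ x (E * i) (F * j) ⟩
    pw x (E * i) ∙ pw x (F * j)      ≡⟨ cong₂ _∙_ (pow-* x E i) (pow-* x F j) ⟩
    pw (pw x E) i ∙ pw (pw x F) j    ≡⟨ cong₂ _∙_ (cong (λ y → pw y i) xᴱ≡x) (cong (λ y → pw y j) xᶠ≡ε) ⟩
    pw x i ∙ pw ε j                  ≡⟨ cong (pw x i ∙_) (pow-ε j) ⟩
    pw x i ∙ ε                       ≡⟨ identityʳ _ ⟩
    pw x i                           ∎
    where open ≡-Reasoning

module AbelianPowers (G : FinGroup) (comm : IsAbelian G) where
  open FinGroup G hiding (order; Carrier; pow)
  open Powers G

  commutativeMonoid : CommutativeMonoid 0ℓ 0ℓ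
  commutativeMonoid = record
    { isCommutativeMonoid = record { isMonoid = Group.isMonoid group ; comm = comm } }

  open import Algebra.Properties.CommutativeMonoid.Mult commutativeMonoid using (×-distrib-+)
  open import Algebra.Properties.CommutativeMonoid.Sum commutativeMonoid
    using (sum; sum-permute; ∑-distrib-+; sum-replicate)

  pow-distrib : ∀ x y k → pw (x ∙ y) k ≡ pw x k ∙ pw y k
  pow-distrib x y k rewrite pow≡× (x ∙ y) k | pow≡× x k | pow≡× y k = ×-distrib-+ x y k

  pow-⁻¹ : ∀ x k → pw (x ⁻¹) k ≡ pw x k ⁻¹
  pow-⁻¹ x k = inverseˡ-unique (pw (x ⁻¹) k) (pw x k) (begin
    pw (x ⁻¹) k ∙ pw x k  ≡⟨ sym (pow-distrib (x ⁻¹) x k) ⟩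
    pw (x ⁻¹ ∙ x) k       ≡⟨ cong (λ y → pw y k) (inverseˡ x) ⟩
    pw ε k                ≡⟨ pow-ε k ⟩
    ε                     ∎)
    where open ≡-Reasoning

  -- Lagrange for abelian groups: the product of all elements is unchanged
  -- by the translation  y ↦ x ∙ y,  hence  x ^ |G| = ε.
  lagrange : ∀ x → pw x (order G) ≡ ε
  lagrange x = identityˡ-unique (pw x (order G)) (sum id) (sym (begin
    sum id                             ≡⟨ sum-permute id translation ⟩
    sum (λ y → x ∙ y)                  ≡⟨ ∑-distrib-+ {order G} (λ _ → x) id ⟩
    sum {order G} (λ _ → x) ∙ sum id   ≡⟨ cong (_∙ sum id) (sum-replicate (order G) {x}) ⟩
    (order G · x) ∙ sum id             ≡⟨ cong (_∙ sum id) (sym (pow≡× x (order G))) ⟩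
    pw x (order G) ∙ sum id            ∎))
    where
      open ≡-Reasoning
      id : Carrier G → Carrier G
      id y = y
      translation : Permutation (order G) (order G)
      translation = permutation (x ∙_) (x ⁻¹ ∙_)
        (λ y → trans (sym (assoc _ _ _)) (trans (cong (_∙ y) (inverseʳ x)) (identityˡ y)))
        (λ y → trans (sym (assoc _ _ _)) (trans (cong (_∙ y) (inverseˡ x)) (identityˡ y)))

  -- Membership in a cyclic subgroup is decidable: by Lagrange it suffices
  -- to search the exponents below |G|.
  _∈⟨_⟩? : ∀ x g → Dec (x ∈⟨ g ⟩)
  x ∈⟨ g ⟩? with any? (λ i → pw g (toℕ i) ≟ᶠ x)
  ... | yes (i , gⁱ≡x) = yes (toℕ i , gⁱ≡x)
  ... | no ∄i = no λ { (k , gᵏ≡x) → ∄i (reduced k , trans (reduced-pow k) gᵏ≡x) }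
    where
      instance _ = order-nonZero
      reduced : ℕ → Fin (order G)
      reduced k = fromℕ< (m%n<n k (order G))
      reduced-pow : ∀ k → pw g (toℕ (reduced k)) ≡ pw g k
      reduced-pow k = trans (cong (pw g) (toℕ-fromℕ< (m%n<n k (order G))))
                            (pow-mod g (order G) k (lagrange g))

first-switch : {P : ℕ → Set} → (∀ n → Dec (P n)) → ∀ r → P r →
               P 0 ⊎ ∃[ m ] (¬ P m × P (suc m))
first-switch P? zero    P0 = inj₁ P0
first-switch P? (suc r) Pr with P? r
... | yes Pr′ = first-switch P? r Pr′
... | no ¬Pr′ = inj₂ (r , ¬Pr′ , Pr)

¬∣⇒coprime : ∀ {p d} → Prime p → ¬ p ∣ d → Coprime d p
¬∣⇒coprime pp p∤d (i∣d , i∣p) with prime⇒irreducible pp i∣p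
... | inj₁ i≡1 = i≡1
... | inj₂ refl = ⊥-elim (p∤d i∣d)

prime-power-divisor : ∀ {p} → Prime p → ∀ m d → d ∣ p ^ suc m → d ≡ p ^ suc m ⊎ d ∣ p ^ m
prime-power-divisor {p} pp m d d∣pᵐ⁺¹ with p ∣? d
... | no p∤d = inj₂ (coprime-divisor (¬∣⇒coprime pp p∤d) d∣pᵐ⁺¹)
prime-power-divisor {p} pp zero d d∣p | yes (divides q refl) =
  inj₁ (trans (cong (_* p) (∣1⇒≡1 (*-cancelˡ-∣ p {{prime⇒nonZero pp}} (subst (_∣ p * 1) (*-comm q p) d∣p))))
              (*-comm 1 p))
prime-power-divisor {p} pp (suc m) d d∣pᵐ⁺² | yes (divides q refl)
  with prime-power-divisor pp m q (*-cancelˡ-∣ p {{prime⇒nonZero pp}} (subst (_∣ p * p ^ suc m) (*-comm q p) d∣pᵐ⁺²))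
... | inj₁ q≡pᵐ⁺¹ = inj₁ (trans (cong (_* p) q≡pᵐ⁺¹) (*-comm _ p))
... | inj₂ q∣pᵐ   = inj₂ (subst (q * p ∣_) (*-comm _ p) (*-monoˡ-∣ p q∣pᵐ))

module PrimeOrder (G : FinGroup) {p : ℕ} (pp : Prime p) where
  open FinGroup G hiding (order; Carrier; pow)
  open Powers G

  instance
    p-nonZero : NonZero p
    p-nonZero = prime⇒nonZero pp

  pow-p^suc : ∀ z m → pw (pw z (p ^ m)) p ≡ pw z (p ^ suc m)
  pow-p^suc z m = trans (sym (pow-* z (p ^ m) p)) (cong (pw z) (*-comm (p ^ m) p))

  order-divides : ∀ w m k → pw w (p ^ m) ≢ ε → pw w (p ^ suc m) ≡ ε → pw w k ≡ ε →
                  p ^ suc m ∣ k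
  order-divides w m k wᵖᵐ≢ε wᵖᵐ⁺¹≡ε wᵏ≡ε
    with prime-power-divisor pp m (gcd (p ^ suc m) k) (gcd[m,n]∣m (p ^ suc m) k)
  ... | inj₁ gcd≡pᵐ⁺¹ = subst (_∣ k) gcd≡pᵐ⁺¹ (gcd[m,n]∣n (p ^ suc m) k)
  ... | inj₂ gcd∣pᵐ   = ⊥-elim (wᵖᵐ≢ε (pow-∣ w (pow-gcd w (p ^ suc m) k wᵖᵐ⁺¹≡ε wᵏ≡ε) gcd∣pᵐ))

  order-p-generated : ∀ c t → pw c p ≡ ε → pw c t ≢ ε → c ∈⟨ pw c t ⟩
  order-p-generated c t cᵖ≡ε cᵗ≢ε = coprime-power-generates c (pred p) t
    (subst (λ q → pw c q ≡ ε) p≡suc[pred] cᵖ≡ε)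
    (subst (Coprime t) p≡suc[pred] (¬∣⇒coprime pp λ p∣t → cᵗ≢ε (pow-∣ c cᵖ≡ε p∣t)))
    where p≡suc[pred] = sym (suc-pred p)

module PrimePowerExponent (G : FinGroup) {p : ℕ} (pp : Prime p) (r : ℕ)
                          (exponent : ∀ x → pow G x (p ^ r) ≡ FinGroup.ε G) where
  open FinGroup G hiding (order; Carrier; pow)
  open Powers G
  open PrimeOrder G pp

  exact-order : ∀ z → z ≢ ε → ∃[ m ] (pw z (p ^ m) ≢ ε × pw z (p ^ suc m) ≡ ε)
  exact-order z z≢ε with first-switch (λ j → pw z (p ^ j) ≟ᶠ ε) r (exponent z)
  ... | inj₁ z¹≡ε = ⊥-elim (z≢ε (trans (sym (pow-1 z)) z¹≡ε))
  ... | inj₂ m    = m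

  power-of-order-p : ∀ z → z ≢ ε → ∃[ c ] (c ∈⟨ z ⟩ × c ≢ ε × pw c p ≡ ε)
  power-of-order-p z z≢ε with exact-order z z≢ε
  ... | m , zᵖᵐ≢ε , zᵖᵐ⁺¹≡ε = pw z (p ^ m) , (p ^ m , refl) , zᵖᵐ≢ε , trans (pow-p^suc z m) zᵖᵐ⁺¹≡ε

  unique-subgroup-of-order-p : ∀ {w a c} → a ∈⟨ w ⟩ → c ∈⟨ w ⟩ →
    pw a p ≡ ε → pw c p ≡ ε → c ≢ ε → a ∈⟨ c ⟩
  unique-subgroup-of-order-p {w} (γ₁ , refl) (γ₂ , refl) aᵖ≡ε cᵖ≡ε c≢ε
    with exact-order w (λ w≡ε → c≢ε (trans (cong (λ y → pw y γ₂) w≡ε) (pow-ε γ₂)))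
  ... | m , wᵖᵐ≢ε , wᵖᵐ⁺¹≡ε = ∈⟨⟩-trans (in-⟨d⟩ γ₁ aᵖ≡ε) d∈⟨c⟩
    where
      d = pw w (p ^ m)
      dᵖ≡ε : pw d p ≡ ε
      dᵖ≡ε = trans (pow-p^suc w m) wᵖᵐ⁺¹≡ε
      -- an element w ^ γ killed by p has p ^ m ∣ γ, so it is a power of d
      in-⟨d⟩ : ∀ γ → pw (pw w γ) p ≡ ε → ∃[ t ] (pw d t ≡ pw w γ)
      in-⟨d⟩ γ wᵞᵖ≡ε
        with *-cancelˡ-∣ p (subst (p * p ^ m ∣_) (*-comm γ p)
               (order-divides w m (γ * p) wᵖᵐ≢ε wᵖᵐ⁺¹≡ε (trans (pow-* w γ p) wᵞᵖ≡ε)))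
      ... | divides t refl = t , trans (sym (pow-* w (p ^ m) t)) (cong (pw w) (*-comm (p ^ m) t))
      d∈⟨c⟩ : d ∈⟨ pw w γ₂ ⟩
      d∈⟨c⟩ with in-⟨d⟩ γ₂ cᵖ≡ε
      ... | t , dᵗ≡c = subst (λ y → d ∈⟨ y ⟩) dᵗ≡c
                         (order-p-generated d t dᵖ≡ε (λ dᵗ≡ε → c≢ε (trans (sym dᵗ≡c) dᵗ≡ε)))

module CyclicityCriterion (G : FinGroup) (comm : IsAbelian G) {p : ℕ} (pp : Prime p) (r : ℕ)
                          (exponent : ∀ x → pow G x (p ^ r) ≡ FinGroup.ε G) where
  open FinGroup G hiding (order; Carrier; pow)
  open Powers G
  open AbelianPowers G comm
  open PrimeOrder G pp

  -- Let g have order p ^ (m+1), the exponent of G, and contain every element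
  -- of order p.  Then x ∈ ⟨ g ⟩ as soon as x ^ p ∈ ⟨ g ⟩: write x ^ p = g ^ k;
  -- maximality of the order of g forces k = j * p, and y = x ∙ (g ^ j)⁻¹ has
  -- y ^ p = ε, so y ∈ ⟨ g ⟩ and x = y ∙ g ^ j.
  module MaximalOrder (g : Carrier G) (m : ℕ) (gᵖᵐ≢ε : pw g (p ^ m) ≢ ε)
                      (exp : ∀ x → pw x (p ^ suc m) ≡ ε)
                      (order-p⊆⟨g⟩ : ∀ y → pw y p ≡ ε → y ∈⟨ g ⟩) where

    root-in-⟨g⟩ : ∀ x → pw x p ∈⟨ g ⟩ → x ∈⟨ g ⟩
    root-in-⟨g⟩ x (k , gᵏ≡xᵖ)
      with *-cancelʳ-∣ {p} {k} (p ^ m) {{m^n≢0 p m}} (order-divides g m (k * p ^ m) gᵖᵐ≢ε (exp g) gᵏᵖᵐ≡ε)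
      where
        gᵏᵖᵐ≡ε : pw g (k * p ^ m) ≡ ε
        gᵏᵖᵐ≡ε = begin
          pw g (k * p ^ m)     ≡⟨ pow-* g k (p ^ m) ⟩
          pw (pw g k) (p ^ m)  ≡⟨ cong (λ z → pw z (p ^ m)) gᵏ≡xᵖ ⟩
          pw (pw x p) (p ^ m)  ≡⟨ sym (pow-* x p (p ^ m)) ⟩
          pw x (p ^ suc m)     ≡⟨ exp x ⟩
          ε                    ∎
          where open ≡-Reasoning
    ... | divides j refl with order-p⊆⟨g⟩ y yᵖ≡ε
      where
        y = x ∙ pw g j ⁻¹
        yᵖ≡ε : pw y p ≡ ε
        yᵖ≡ε = begin
          pw y p                                ≡⟨ pow-distrib x (pw g j ⁻¹) p ⟩
          pw x p ∙ pw (pw g j ⁻¹) p             ≡⟨ cong₂ _∙_ (sym gᵏ≡xᵖ) (pow-⁻¹ (pw g j) p) ⟩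
          pw g (j * p) ∙ pw (pw g j) p ⁻¹       ≡⟨ cong (λ z → pw g (j * p) ∙ z ⁻¹) (sym (pow-* g j p)) ⟩
          pw g (j * p) ∙ pw g (j * p) ⁻¹        ≡⟨ inverseʳ _ ⟩
          ε                                     ∎
          where open ≡-Reasoning
    ... | t , gᵗ≡y = t + j , (begin
          pw g (t + j)                ≡⟨ pow-+ g t j ⟩
          pw g t ∙ pw g j             ≡⟨ cong (_∙ pw g j) gᵗ≡y ⟩
          (x ∙ pw g j ⁻¹) ∙ pw g j    ≡⟨ assoc _ _ _ ⟩
          x ∙ (pw g j ⁻¹ ∙ pw g j)    ≡⟨ cong (x ∙_) (inverseˡ _) ⟩
          x ∙ ε                       ≡⟨ identityʳ x ⟩
          x                           ∎)
      where open ≡-Reasoning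

    generates : ∀ s x → pw x (p ^ s) ≡ ε → x ∈⟨ g ⟩
    generates zero    x x¹≡ε   = 0 , sym (trans (sym (pow-1 x)) x¹≡ε)
    generates (suc s) x xᵖˢ⁺¹≡ε =
      root-in-⟨g⟩ x (generates s (pw x p) (trans (sym (pow-* x p (p ^ s))) xᵖˢ⁺¹≡ε))

  -- Choose g of maximal order p ^ (m+1); the order-p element c = g ^ p ^ m is
  -- a power of a, hence generates ⟨ a ⟩, so all elements of order p lie in
  -- ⟨ g ⟩ and MaximalOrder applies.
  cyclic-criterion : ∀ a → a ≢ ε → pw a p ≡ ε → (∀ b → pw b p ≡ ε → b ∈⟨ a ⟩) → IsCyclic G
  cyclic-criterion a a≢ε aᵖ≡ε order-p⊆⟨a⟩
    with first-switch (λ m → all? (λ x → pw x (p ^ m) ≟ᶠ ε)) r exponent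
  ... | inj₁ trivial = ⊥-elim (a≢ε (trans (sym (pow-1 a)) (trivial a)))
  ... | inj₂ (m , ¬exp , exp) with ¬∀⟶∃¬ _ _ (λ x → pw x (p ^ m) ≟ᶠ ε) ¬exp
  ... | g , gᵖᵐ≢ε = g , λ x → let k , gᵏ≡x = generates (suc m) x (exp x) in k , sym gᵏ≡x
    where
      c = pw g (p ^ m)
      -- c has order p, so it is a nontrivial power of a and generates ⟨ a ⟩
      a∈⟨c⟩ : a ∈⟨ c ⟩
      a∈⟨c⟩ with order-p⊆⟨a⟩ c (trans (pow-p^suc g m) (exp g))
      ... | u , aᵘ≡c = subst (a ∈⟨_⟩) aᵘ≡c
                         (order-p-generated a u aᵖ≡ε (λ aᵘ≡ε → gᵖᵐ≢ε (trans (sym aᵘ≡c) aᵘ≡ε)))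
      open MaximalOrder g m gᵖᵐ≢ε exp
             (λ y yᵖ≡ε → ∈⟨⟩-trans (∈⟨⟩-trans (order-p⊆⟨a⟩ y yᵖ≡ε) a∈⟨c⟩) (p ^ m , refl))

rank : ∀ {N x} (S : Subset N) → x ∈ S → Fin ∣ S ∣
rank (inside  ∷ S) here      = zero
rank (inside  ∷ S) (there m) = suc (rank S m)
rank (outside ∷ S) (there m) = rank S m

rank-injective : ∀ {N x y} (S : Subset N) (x∈S : x ∈ S) (y∈S : y ∈ S) →
                 rank S x∈S ≡ rank S y∈S → x ≡ y
rank-injective (inside  ∷ S) here       here       _  = refl
rank-injective (inside  ∷ S) (there x∈S) (there y∈S) eq =
  cong suc (rank-injective S x∈S y∈S (suc-injective eq))
rank-injective (outside ∷ S) (there x∈S) (there y∈S) eq = cong suc (rank-injective S x∈S y∈S eq)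

unrank : ∀ {N} (S : Subset N) → Fin ∣ S ∣ → Fin N
unrank (inside  ∷ S) zero    = zero
unrank (inside  ∷ S) (suc j) = suc (unrank S j)
unrank (outside ∷ S) j       = suc (unrank S j)

unrank-∈ : ∀ {N} (S : Subset N) j → unrank S j ∈ S
unrank-∈ (inside  ∷ S) zero    = here
unrank-∈ (inside  ∷ S) (suc j) = there (unrank-∈ S j)
unrank-∈ (outside ∷ S) j       = there (unrank-∈ S j)

unrank-injective : ∀ {N} (S : Subset N) i j → unrank S i ≡ unrank S j → i ≡ j
unrank-injective (inside  ∷ S) zero    zero    _  = refl
unrank-injective (inside  ∷ S) (suc i) (suc j) eq = cong suc (unrank-injective S i j (suc-injective eq))
unrank-injective (outside ∷ S) i       j       eq = unrank-injective S i j (suc-injective eq)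

injection⇒≤∣∣ : ∀ {n N} (S : Subset N) (g : Fin n → Fin N) → (∀ i j → g i ≡ g j → i ≡ j) →
                (∀ i → g i ∈ S) → n ≤ ∣ S ∣
injection⇒≤∣∣ S g g-inj g∈S = ≮⇒≥ λ ∣S∣<n →
  let i , j , i<j , same-rank = pigeonhole ∣S∣<n (λ i → rank S (g∈S i))
  in <⇒≢ i<j (cong toℕ (g-inj i j (rank-injective S (g∈S i) (g∈S j) same-rank)))

surjection⇒∣∣≤ : ∀ {n N} (S : Subset N) (g : Fin n → Fin N) →
                 (∀ x → x ∈ S → ∃[ i ] g i ≡ x) → ∣ S ∣ ≤ n
surjection⇒∣∣≤ {n} S g g-covers = ≮⇒≥ λ n<∣S∣ →
  let i , j , i<j , same-preimage = pigeonhole n<∣S∣ preimage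
  in <⇒≢ i<j (cong toℕ (unrank-injective S i j
       (trans (sym (proj₂ (cover i))) (trans (cong g same-preimage) (proj₂ (cover j))))))
  where
    cover : ∀ j → ∃[ i ] g i ≡ unrank S j
    cover j = g-covers (unrank S j) (unrank-∈ S j)
    preimage : Fin ∣ S ∣ → Fin n
    preimage j = proj₁ (cover j)

image : ∀ {n N} (g : Fin n → Fin N) → Subset N
image g = tabulate (λ x → does (any? (λ i → g i ≟ᶠ x)))

image-∈ : ∀ {n N} (g : Fin n → Fin N) i → g i ∈ image g
image-∈ g i = lookup⇒[]= (g i) (image g) (trans (lookup∘tabulate _ (g i)) hit)
  where
    hit : does (any? (λ k → g k ≟ᶠ g i)) ≡ inside
    hit with any? (λ k → g k ≟ᶠ g i)
    ... | yes _ = refl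
    ... | no ∄k = contradiction (i , refl) ∄k

image-preimage : ∀ {n N} (g : Fin n → Fin N) x → x ∈ image g → ∃[ i ] g i ≡ x
image-preimage g x x∈image = found (trans (sym (lookup∘tabulate _ x)) ([]=⇒lookup x∈image))
  where
    found : does (any? (λ k → g k ≟ᶠ x)) ≡ inside → ∃[ i ] g i ≡ x
    found _  with any? (λ k → g k ≟ᶠ x)
    found _     | yes witness = witness
    found ()    | no _

∣image∣ : ∀ {n N} (g : Fin n → Fin N) → (∀ i j → g i ≡ g j → i ≡ j) → ∣ image g ∣ ≡ n
∣image∣ g g-inj = ≤-antisym (surjection⇒∣∣≤ (image g) g (image-preimage g))
                            (injection⇒≤∣∣ (image g) g g-inj (image-∈ g))

reach-invariant : ∀ {N} {Adj : Fin N → Fin N → Set} {S : Subset N} (P : Fin N → Set) →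
  (∀ {x y} → y ∉ S → Adj x y → P x → P y) →
  ∀ {x y} → ReachAvoiding Adj S x y → P x → P y
reach-invariant P transport (here _) Px = Px
reach-invariant P transport (step _ x~y rest) Px =
  reach-invariant P transport rest (transport (start rest) x~y Px)
  where
    start : ∀ {y z} → ReachAvoiding _ _ y z → y ∉ _
    start (here y∉S)     = y∉S
    start (step y∉S _ _) = y∉S

dominating-vertex-connects : ∀ {N} {Adj : Fin N → Fin N → Set} {S : Subset N} (t : Fin N) →
  t ∉ S → (∀ u → u ≢ t → Adj u t × Adj t u) →
  ∀ x y → x ∉ S → y ∉ S → ReachAvoiding Adj S x y
dominating-vertex-connects t t∉S dominates x y x∉S y∉S with x ≟ᶠ y | x ≟ᶠ t | y ≟ᶠ t
... | yes refl | _        | _        = here x∉S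
... | no x≢y   | yes refl | _        = step x∉S (proj₂ (dominates y (λ y≡x → x≢y (sym y≡x)))) (here y∉S)
... | no _     | no x≢t   | yes refl = step x∉S (proj₁ (dominates x x≢t)) (here y∉S)
... | no _     | no x≢t   | no y≢t   =
  step x∉S (proj₁ (dominates x x≢t)) (step t∉S (proj₂ (dominates y y≢t)) (here y∉S))

image-abelian : (G K : FinGroup) (h : Carrier G → Carrier K) →
  (∀ x y → h (FinGroup._∙_ G x y) ≡ FinGroup._∙_ K (h x) (h y)) →
  (∀ z → ∃[ x ] h x ≡ z) → IsAbelian G → IsAbelian K
image-abelian G K h h-homo h-onto comm a b
  with h-onto a | h-onto b
... | x , refl | y , refl = begin
  h x ∙ h y    ≡⟨ sym (h-homo x y) ⟩
  h (x ∙ᴳ y)   ≡⟨ cong h (comm x y) ⟩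
  h (y ∙ᴳ x)   ≡⟨ h-homo y x ⟩
  h y ∙ h x    ∎
  where
    open ≡-Reasoning
    open FinGroup K using (_∙_)
    open FinGroup G using () renaming (_∙_ to _∙ᴳ_)

crt-exponent : ∀ q n .{{_ : NonZero n}} → Coprime q n → ∃[ E ] ∃[ s ] (E ≡ 1 + q * s × n ∣ E)
crt-exponent q (suc n) q⊥n with coprime-Bézout q⊥n
... | Bézout.-+ x y 1+x*q≡y*[n+1] =
  y * suc n , x , trans (sym 1+x*q≡y*[n+1]) (cong (1 +_) (*-comm x q)) , divides y refl
... | Bézout.+- x y 1+y*[n+1]≡x*q = 1 + q * (x * n) , x * n , refl , divides (1 + y * n) (begin
  1 + q * (x * n)             ≡⟨ cong (1 +_) (reassociate q x n) ⟩
  1 + (x * q) * n             ≡⟨ cong (λ z → 1 + z * n) (sym 1+y*[n+1]≡x*q) ⟩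
  1 + (1 + y * suc n) * n     ≡⟨ regroup y n ⟩
  (1 + y * n) * suc n         ∎)
  where
    open ≡-Reasoning
    reassociate : ∀ q x n → q * (x * n) ≡ (x * q) * n
    reassociate = solve-∀
    regroup : ∀ y n → 1 + (1 + y * suc n) * n ≡ (1 + y * n) * suc n
    regroup = solve-∀

module CoprimeDecomposition (G G₁ H : FinGroup) (iso : IsoToProduct G G₁ H) (comm : IsAbelian G)
                            (coprime : Coprime (order G₁) (order H)) where
  module G  = FinGroup G
  module G₁ = FinGroup G₁
  module H  = FinGroup H
  module PG  = Powers G
  module PG₁ = Powers G₁
  module PH  = Powers H
  open IsoToProduct iso

  f⁻¹ : Carrier G₁ × Carrier H → Carrier G
  f⁻¹ z = proj₁ (surjective z)

  f∘f⁻¹ : ∀ z → f (f⁻¹ z) ≡ z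
  f∘f⁻¹ z = proj₂ (surjective z)

  f-ε : f G.ε ≡ (G₁.ε , H.ε)
  f-ε = cong₂ _,_ (PG₁.identityʳ-unique _ _ (cong proj₁ fε∙fε≡fε))
                  (PH.identityʳ-unique _ _ (cong proj₂ fε∙fε≡fε))
    where fε∙fε≡fε = trans (sym (homo G.ε G.ε)) (cong f (G.identityˡ G.ε))

  f-pow : ∀ w k → f (pow G w k) ≡ (pow G₁ (proj₁ (f w)) k , pow H (proj₂ (f w)) k)
  f-pow w zero    = f-ε
  f-pow w (suc k) = trans (homo w (pow G w k))
    (cong₂ _,_ (cong (proj₁ (f w) G₁.∙_) (cong proj₁ (f-pow w k)))
               (cong (proj₂ (f w) H.∙_) (cong proj₂ (f-pow w k))))

  component-power : ∀ {u} w k → u ≡ pow G w k → proj₁ (f u) PG₁.∈⟨ proj₁ (f w) ⟩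
  component-power w k refl = k , sym (cong proj₁ (f-pow w k))

  comm₁ : IsAbelian G₁
  comm₁ = image-abelian G G₁ (λ x → proj₁ (f x)) (λ x y → cong proj₁ (homo x y))
            (λ a → f⁻¹ (a , H.ε) , cong proj₁ (f∘f⁻¹ _)) comm

  commH : IsAbelian H
  commH = image-abelian G H (λ x → proj₂ (f x)) (λ x y → cong proj₂ (homo x y))
            (λ h → f⁻¹ (G₁.ε , h) , cong proj₂ (f∘f⁻¹ _)) comm

  lagrange₁ : ∀ x → pow G₁ x (order G₁) ≡ G₁.ε
  lagrange₁ = AbelianPowers.lagrange G₁ comm₁

  lagrangeH : ∀ h → pow H h (order H) ≡ H.ε
  lagrangeH = AbelianPowers.lagrange H commH

  instance
    G₁-nonZero = PG₁.order-nonZero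
    H-nonZero  = PH.order-nonZero

  E₁ Eₕ : ℕ
  E₁ = proj₁ (crt-exponent (order G₁) (order H) coprime)
  Eₕ = proj₁ (crt-exponent (order H) (order G₁) (Coprimality.sym coprime))

  E₁-on-G₁ : ∀ x → pow G₁ x E₁ ≡ x
  E₁-on-G₁ x with crt-exponent (order G₁) (order H) coprime
  ... | _ , s , refl , _ = PG₁.pow-1+ x (order G₁) s (lagrange₁ x)

  Eₕ-on-G₁ : ∀ x → pow G₁ x Eₕ ≡ G₁.ε
  Eₕ-on-G₁ x with crt-exponent (order H) (order G₁) (Coprimality.sym coprime)
  ... | _ , _ , _ , |G₁|∣Eₕ = PG₁.pow-∣ x (lagrange₁ x) |G₁|∣Eₕ

  Eₕ-on-H : ∀ h → pow H h Eₕ ≡ h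
  Eₕ-on-H h with crt-exponent (order H) (order G₁) (Coprimality.sym coprime)
  ... | _ , s , refl , _ = PH.pow-1+ h (order H) s (lagrangeH h)

  E₁-on-H : ∀ h → pow H h E₁ ≡ H.ε
  E₁-on-H h with crt-exponent (order G₁) (order H) coprime
  ... | _ , _ , _ , |H|∣E₁ = PH.pow-∣ h (lagrangeH h) |H|∣E₁

  pair-∈⟨⟩ : ∀ x z → proj₁ (f x) PG₁.∈⟨ proj₁ z ⟩ → proj₂ (f x) PH.∈⟨ proj₂ z ⟩ → x PG.∈⟨ f⁻¹ z ⟩
  pair-∈⟨⟩ x (a , b) (i , aⁱ≡x₁) (j , bʲ≡x₂) = E₁ * i + Eₕ * j , injective _ _ (begin
    f (pow G w k)                                   ≡⟨ f-pow w k ⟩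
    (pow G₁ (proj₁ (f w)) k , pow H (proj₂ (f w)) k) ≡⟨ cong (λ z → pow G₁ (proj₁ z) k , pow H (proj₂ z) k) (f∘f⁻¹ _) ⟩
    (pow G₁ a k , pow H b k)                        ≡⟨ cong₂ _,_ on-G₁ on-H ⟩
    f x                                             ∎)
    where
      open ≡-Reasoning
      w = f⁻¹ (a , b)
      k = E₁ * i + Eₕ * j
      on-G₁ : pow G₁ a k ≡ proj₁ (f x)
      on-G₁ = trans (PG₁.pow-projection a E₁ Eₕ i j (E₁-on-G₁ a) (Eₕ-on-G₁ a)) aⁱ≡x₁
      on-H : pow H b k ≡ proj₂ (f x)
      on-H = trans (cong (pow H b) (+-comm (E₁ * i) (Eₕ * j)))
               (trans (PH.pow-projection b Eₕ E₁ j i (Eₕ-on-H b) (E₁-on-H b)) bʲ≡x₂)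

  embedH : Carrier H → Carrier G
  embedH h = f⁻¹ (G₁.ε , h)

  embedH-injective : ∀ h h′ → embedH h ≡ embedH h′ → h ≡ h′
  embedH-injective h h′ eq =
    trans (sym (cong proj₂ (f∘f⁻¹ _))) (trans (cong (λ z → proj₂ (f z)) eq) (cong proj₂ (f∘f⁻¹ _)))

  Hˢ : Subset (order G)
  Hˢ = image embedH

  ∣Hˢ∣ : ∣ Hˢ ∣ ≡ order H
  ∣Hˢ∣ = ∣image∣ embedH embedH-injective

  ∉Hˢ⇒nontrivial : ∀ u → u ∉ Hˢ → proj₁ (f u) ≢ G₁.ε
  ∉Hˢ⇒nontrivial u u∉Hˢ u₁≡ε = u∉Hˢ (subst (_∈ Hˢ) (injective _ _ same-image) (image-∈ embedH (proj₂ (f u))))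
    where
      same-image : f (embedH (proj₂ (f u))) ≡ f u
      same-image = trans (f∘f⁻¹ _) (cong (_, proj₂ (f u)) (sym u₁≡ε))

  nontrivial⇒∉Hˢ : ∀ u → proj₁ (f u) ≢ G₁.ε → u ∉ Hˢ
  nontrivial⇒∉Hˢ u u₁≢ε u∈Hˢ with image-preimage embedH u u∈Hˢ
  ... | h , refl = u₁≢ε (cong proj₁ (f∘f⁻¹ _))

  common-power-adjacent : ∀ {u v w} → u ≢ v → u PG.∈⟨ w ⟩ → v PG.∈⟨ w ⟩ → EnhancedPowerAdj G u v
  common-power-adjacent u≢v (i , wⁱ≡u) (j , wʲ≡v) = u≢v , _ , i , j , sym wⁱ≡u , sym wʲ≡v

  -- If H is cyclic, each vertex of Hˢ is adjacent to every other vertex: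
  -- u and embedH h are both powers of f⁻¹ (u₁ , g) for a generator g of H.
  embedH-dominates : IsCyclic H → ∀ h u → u ≢ embedH h →
                     EnhancedPowerAdj G u (embedH h) × EnhancedPowerAdj G (embedH h) u
  embedH-dominates (g , generates) h u u≢embedH =
    common-power-adjacent u≢embedH u∈⟨w⟩ h∈⟨w⟩ ,
    common-power-adjacent (λ eq → u≢embedH (sym eq)) h∈⟨w⟩ u∈⟨w⟩
    where
      generated : ∀ h → h PH.∈⟨ g ⟩
      generated h = let k , h≡gᵏ = generates h in k , sym h≡gᵏ
      u∈⟨w⟩ = pair-∈⟨⟩ u (proj₁ (f u) , g) (1 , PG₁.pow-1 _) (generated (proj₂ (f u)))
      h∈⟨w⟩ = pair-∈⟨⟩ (embedH h) (proj₁ (f u) , g)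
                (0 , sym (cong proj₁ (f∘f⁻¹ _))) (subst (PH._∈⟨ g ⟩) (sym (cong proj₂ (f∘f⁻¹ _))) (generated h))

  -- Lower bound: a set of fewer than |H| vertices misses some embedH h,
  -- which is adjacent to all other vertices, so it cannot disconnect.
  small-sets-connected : IsCyclic H → ∀ S → ∣ S ∣ < order H → ¬ Disconnects (EnhancedPowerAdj G) S
  small-sets-connected cyclic S ∣S∣<|H| (x , y , x∉S , y∉S , ¬x⇝y) with all? (λ h → embedH h ∈? S)
  ... | yes Hˢ⊆S = <⇒≱ ∣S∣<|H| (injection⇒≤∣∣ S embedH embedH-injective Hˢ⊆S)
  ... | no Hˢ⊈S with ¬∀⟶∃¬ _ _ (λ h → embedH h ∈? S) Hˢ⊈S
  ... | h , embedH-h∉S = ¬x⇝y (dominating-vertex-connects (embedH h) embedH-h∉S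
                                 (embedH-dominates cyclic h) x y x∉S y∉S)

module DisconnectingSet (G G₁ H : FinGroup) (iso : IsoToProduct G G₁ H) (comm : IsAbelian G)
                        (coprime : Coprime (order G₁) (order H))
                        {p : ℕ} (pp : Prime p) (r : ℕ) (|G₁|≡pʳ : order G₁ ≡ p ^ r)
                        (noncyclic₁ : ¬ IsCyclic G₁) where
  open CoprimeDecomposition G G₁ H iso comm coprime
  open IsoToProduct iso
  open FinGroup G₁ using (ε)
  open Powers G₁

  exponent₁ : ∀ x → pow G₁ x (p ^ r) ≡ ε
  exponent₁ x = subst (λ N → pow G₁ x N ≡ ε) |G₁|≡pʳ (lagrange₁ x)

  open AbelianPowers G₁ comm₁ using (_∈⟨_⟩?)
  open PrimeOrder G₁ pp using (order-p-generated)
  open PrimePowerExponent G₁ pp r exponent₁ using (power-of-order-p; unique-subgroup-of-order-p)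
  open CyclicityCriterion G₁ comm₁ pp r exponent₁ using (cyclic-criterion)

  nontrivial : ∃[ x ] x ≢ ε
  nontrivial with all? (λ x → x ≟ᶠ ε)
  ... | yes trivial = ⊥-elim (noncyclic₁ (ε , λ x → 0 , trivial x))
  ... | no ¬trivial = ¬∀⟶∃¬ _ _ (λ x → x ≟ᶠ ε) ¬trivial

  a : Carrier G₁
  a = proj₁ (power-of-order-p _ (proj₂ nontrivial))

  a≢ε : a ≢ ε
  a≢ε = proj₁ (proj₂ (proj₂ (power-of-order-p _ (proj₂ nontrivial))))

  aᵖ≡ε : pw a p ≡ ε
  aᵖ≡ε = proj₂ (proj₂ (proj₂ (power-of-order-p _ (proj₂ nontrivial))))

  b-exists : ∃[ b ] (pw b p ≡ ε × ¬ b ∈⟨ a ⟩)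
  b-exists with all? (λ b → (pw b p ≟ᶠ ε) →-dec (b ∈⟨ a ⟩?))
  ... | yes order-p⊆⟨a⟩ = ⊥-elim (noncyclic₁ (cyclic-criterion a a≢ε aᵖ≡ε order-p⊆⟨a⟩))
  ... | no ¬order-p⊆⟨a⟩ with ¬∀⟶∃¬ _ _ (λ b → (pw b p ≟ᶠ ε) →-dec (b ∈⟨ a ⟩?)) ¬order-p⊆⟨a⟩
  ... | b , b-outside with pw b p ≟ᶠ ε
  ...   | yes bᵖ≡ε = b , bᵖ≡ε , λ b∈⟨a⟩ → b-outside (λ _ → b∈⟨a⟩)
  ...   | no  bᵖ≢ε = ⊥-elim (b-outside (λ bᵖ≡ε → ⊥-elim (bᵖ≢ε bᵖ≡ε)))

  b : Carrier G₁
  b = proj₁ b-exists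

  -- Invariant along paths avoiding Hˢ: a is a power of the G₁-component.
  Sees-a : Carrier G → Set
  Sees-a u = a ∈⟨ proj₁ (f u) ⟩

  -- If x and y are powers of w and y₁ ≠ ε, then ⟨ y₁ ⟩ contains the unique
  -- subgroup of order p of the cyclic p-group ⟨ w₁ ⟩, which contains a.
  sees-a-step : ∀ {x y} → y ∉ Hˢ → EnhancedPowerAdj G x y → Sees-a x → Sees-a y
  sees-a-step {y = y} y∉Hˢ (_ , w , α , β , x≡wᵅ , y≡wᵝ) a∈⟨x₁⟩
    with power-of-order-p (proj₁ (f y)) (∉Hˢ⇒nontrivial y y∉Hˢ)
  ... | c , c∈⟨y₁⟩ , c≢ε , cᵖ≡ε =
    ∈⟨⟩-trans (unique-subgroup-of-order-p (∈⟨⟩-trans a∈⟨x₁⟩ (component-power w α x≡wᵅ))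
                (∈⟨⟩-trans c∈⟨y₁⟩ (component-power w β y≡wᵝ)) aᵖ≡ε cᵖ≡ε c≢ε)
              c∈⟨y₁⟩

  Hˢ-disconnects : Disconnects (EnhancedPowerAdj G) Hˢ
  Hˢ-disconnects = xₐ , x_b ,
    nontrivial⇒∉Hˢ xₐ (λ a≡ε → a≢ε (trans (sym first-xₐ) a≡ε)) ,
    nontrivial⇒∉Hˢ x_b (λ b≡ε → b∉⟨a⟩ (0 , sym (trans (sym first-x_b) b≡ε))) ,
    λ path → ¬sees-a-x_b (reach-invariant Sees-a sees-a-step path sees-a-xₐ)
    where
      xₐ x_b : Carrier G
      xₐ  = f⁻¹ (a , FinGroup.ε H)
      x_b = f⁻¹ (b , FinGroup.ε H)
      first-xₐ : proj₁ (f xₐ) ≡ a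
      first-xₐ = cong proj₁ (f∘f⁻¹ _)
      first-x_b : proj₁ (f x_b) ≡ b
      first-x_b = cong proj₁ (f∘f⁻¹ _)
      b∉⟨a⟩ : ¬ b ∈⟨ a ⟩
      b∉⟨a⟩ = proj₂ (proj₂ b-exists)
      sees-a-xₐ : Sees-a xₐ
      sees-a-xₐ = 1 , trans (pow-1 _) first-xₐ
      -- a ∈ ⟨ b ⟩ with a ≠ ε would make b a power of a
      ¬sees-a-x_b : ¬ Sees-a x_b
      ¬sees-a-x_b a∈⟨x_b₁⟩ with subst (a ∈⟨_⟩) first-x_b a∈⟨x_b₁⟩
      ... | k , bᵏ≡a = b∉⟨a⟩ (subst (b ∈⟨_⟩) bᵏ≡a
                          (order-p-generated b k (proj₁ (proj₂ b-exists)) (λ bᵏ≡ε → a≢ε (trans (sym bᵏ≡a) bᵏ≡ε))))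

mainTheorem6 : (G G₁ H : FinGroup) (n : ℕ) →
    IsAbelian G → ¬ IsCyclic G → ¬ IsPGroup G →
    IsCyclic H → order H ≡ n →
    IsoToProduct G G₁ H →
    gcd (order G₁) n ≡ 1 →
    (∃[ p ] IsPGroupFor G₁ p) →
    ¬ IsCyclic G₁ →
    IsVertexConnectivity (EnhancedPowerAdj G) n
mainTheorem6 G G₁ H .(order H) comm _ _ cyclicH refl iso gcd≡1 (p , pp , r , |G₁|≡pʳ) noncyclic₁ =
  (Hˢ , ∣Hˢ∣ , Hˢ-disconnects) , small-sets-connected cyclicH
  where
    coprime : Coprime (order G₁) (order H)
    coprime = gcd≡1⇒coprime gcd≡1
    open CoprimeDecomposition G G₁ H iso comm coprime using (Hˢ; ∣Hˢ∣; small-sets-connected)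
    open DisconnectingSet G G₁ H iso comm coprime pp r |G₁|≡pʳ noncyclic₁ using (Hˢ-disconnects)
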